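{- Fix $k\ge2$. Let $m>0$ have $k$-sandwiching sequence $(a_i,b_i)_{i=1}^n$ with sandwiching values $(m_i)_{i\le n}$. Then (1) if $0\le i<n$ then $m_i\le b_{i+1}<m_{i+1}$; and (2) if $0<i<n$ then $a_i>a_{i+1}$.
   Context: Ackermann function: for $k\ge 2$, $a,b\ge 0$: $A_a(k,-1):=1$, $A_0(k,b):=k^b$, $A_{a+1}(k,b):=A_a(k,\cdot)^k(A_{a+1}(k,b-1))$, with $f^j$ the $j$-fold iterate; write $A_xy=A_x(k,y)$. $k$-normal form and sandwiching: for $m>0$, $m\equiv_k A_ab+c$ means $m=A_ab+c$ and there exist $n\ge1$ and naturals $a_1..a_n$, $b_1..b_n$, $m_0..m_n$ (sandwiching values) with $m_0=0$; for $0\le i<n$: $A_{a_{i+1}}m_i\le m<A_{a_{i+1}+1}m_i$, $A_{a_{i+1}}b_{i+1}\le m<A_{a_{i+1}}(b_{i+1}+1)$, $m_{i+1}=A_{a_{i+1}}b_{i+1}$; $A_0m_n>m$; $a=a_n$, $b=b_n$. The sequence $(a_i,b_i)_{i=1}^n$ is the $k$-sandwiching sequence of $m$ (uniquely determined by $m$). -}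

module Defs where

open import Data.Nat using (ℕ; zero; suc; _^_; _≤_; _<_)
open import Data.Product using (_×_)
open import Relation.Binary.PropositionalEquality using (_≡_)

iter : ℕ → (ℕ → ℕ) → ℕ → ℕ
iter zero    f x = x
iter (suc j) f x = f (iter j f x)

-- Ackermann function  Ack k a b = A_a(k,b)  for b ≥ 0.
-- A_a(k,-1) = 1 is inlined: A_{a+1}(k,0) = A_a(k,·)^k (A_{a+1}(k,-1)) = A_a(k,·)^k 1.
Ack : ℕ → ℕ → ℕ → ℕ
Ack k zero    b       = k ^ b
Ack k (suc a) zero    = iter k (Ack k a) 1
Ack k (suc a) (suc b) = iter k (Ack k a) (Ack k (suc a) b)

-- Sequences are given as
-- functions ℕ → ℕ; only indices 1..n (resp. 0..n) are constrained.
record IsSandwiching (k m n : ℕ) (a b ms : ℕ → ℕ) : Set where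
  field
    n≥1   : 1 ≤ n
    m₀≡0  : ms 0 ≡ 0
    step  : ∀ i → i < n →
              (Ack k (a (suc i)) (ms i) ≤ m)
            × (m < Ack k (suc (a (suc i))) (ms i))
            × (Ack k (a (suc i)) (b (suc i)) ≤ m)
            × (m < Ack k (a (suc i)) (suc (b (suc i))))
            × (ms (suc i) ≡ Ack k (a (suc i)) (b (suc i)))
    final : m < Ack k 0 (ms n)

-- For (1), A_{a_{i+1}} m_i ≤ m < A_{a_{i+1}}(b_{i+1}+1) forces
-- m_i ≤ b_{i+1}, while m_{i+1} = A_{a_{i+1}} b_{i+1} > b_{i+1}. For (2), by (1) at i - 1,
-- A_{a_{i+1}} m_i ≤ m < A_{a_i}(b_i+1) ≤ A_{a_i} m_i, which forces a_{i+1} < a_i.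

module Submission where

open import Defs
open import Data.Nat using (ℕ; zero; suc; _≤_; _<_; _≤′_; ≤′-refl; ≤′-step; _^_; z≤n; z<s; s≤s⁻¹)
open import Data.Nat.Properties
open import Data.Product using (_×_; _,_; proj₂)
open import Relation.Binary.Definitions using (Monotonic₁)
open import Relation.Binary.PropositionalEquality using (subst; sym)

Monotone : (ℕ → ℕ) → Set
Monotone = Monotonic₁ _≤_ _≤_

step-mono⇒monotone : ∀ {f : ℕ → ℕ} → (∀ n → f n ≤ f (suc n)) → Monotone f
step-mono⇒monotone {f} f≤ m≤n = go (≤⇒≤′ m≤n)
  where
  go : ∀ {m n} → m ≤′ n → f m ≤ f n
  go ≤′-refl       = ≤-refl
  go (≤′-step m≤n) = ≤-trans (go m≤n) (f≤ _)

step-increasing⇒inflationary : ∀ {f : ℕ → ℕ} → (∀ n → f n < f (suc n)) → 0 < f 0 → ∀ n → n < f n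
step-increasing⇒inflationary f< f0>0 zero    = f0>0
step-increasing⇒inflationary {f} f< f0>0 (suc n) = ≤-<-trans (step-increasing⇒inflationary {f} f< f0>0 n) (f< n)

monotone-reflects-< : ∀ {f : ℕ → ℕ} {m n} → Monotone f → f m < f n → m < n
monotone-reflects-< mono fm<fn = ≰⇒> (λ n≤m → <⇒≱ fm<fn (mono n≤m))

iter-inflationary : ∀ {f : ℕ → ℕ} → (∀ x → x ≤ f x) → ∀ j x → x ≤ iter j f x
iter-inflationary f≥ zero    x = ≤-refl
iter-inflationary f≥ (suc j) x = ≤-trans (iter-inflationary f≥ j x) (f≥ _)

iter-strictly-inflationary : ∀ {f : ℕ → ℕ} → (∀ x → x < f x) → ∀ {j} → 0 < j → ∀ x → x < iter j f x
iter-strictly-inflationary f> {suc j} _ x = ≤-<-trans (iter-inflationary (λ y → <⇒≤ (f> y)) j x) (f> _)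

f≤iter : ∀ {f : ℕ → ℕ} → Monotone f → (∀ x → x ≤ f x) → ∀ {j} → 0 < j → ∀ x → f x ≤ iter j f x
f≤iter mono f≥ {suc j} _ x = mono (iter-inflationary f≥ j x)

module _ {k : ℕ} (1<k : 1 < k) where

  private
    0<k : 0 < k
    0<k = <-trans z<s 1<k

  mutual
    Ack-step : ∀ a b → Ack k a b < Ack k a (suc b)
    Ack-step zero    b = ^-monoʳ-< k 1<k (n<1+n b)
    Ack-step (suc a) b = iter-strictly-inflationary (Ack-inflationary a) 0<k _

    Ack-inflationary : ∀ a b → b < Ack k a b
    Ack-inflationary a = step-increasing⇒inflationary {Ack k a} (Ack-step a) (Ack-positive a)

    Ack-positive : ∀ a → 0 < Ack k a 0
    Ack-positive zero    = z<s
    Ack-positive (suc a) = <-≤-trans z<s (iter-inflationary (λ x → <⇒≤ (Ack-inflationary a x)) k 1)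

  Ack-≤-inflationary : ∀ a b → b ≤ Ack k a b
  Ack-≤-inflationary a b = <⇒≤ (Ack-inflationary a b)

  Ack-monoʳ : ∀ a → Monotone (Ack k a)
  Ack-monoʳ a = step-mono⇒monotone {Ack k a} (λ b → <⇒≤ (Ack-step a b))

  Ack-suc-level : ∀ a b → Ack k a b ≤ Ack k (suc a) b
  Ack-suc-level a zero    =
    ≤-trans (Ack-monoʳ a z≤n) (f≤iter (Ack-monoʳ a) (Ack-≤-inflationary a) 0<k 1)
  Ack-suc-level a (suc b) =
    ≤-trans (Ack-monoʳ a (Ack-inflationary (suc a) b)) (f≤iter (Ack-monoʳ a) (Ack-≤-inflationary a) 0<k _)

  Ack-monoˡ : ∀ b → Monotone (λ a → Ack k a b)
  Ack-monoˡ b = step-mono⇒monotone {λ a → Ack k a b} (λ a → Ack-suc-level a b)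

lemma3p1 : (k m n : ℕ) (a b ms : ℕ → ℕ) → 2 ≤ k → 0 < m →
           IsSandwiching k m n a b ms →
           (∀ i → i < n → (ms i ≤ b (suc i)) × (b (suc i) < ms (suc i)))
           × (∀ i → 0 < i → i < n → a (suc i) < a i)
lemma3p1 k m n a b ms 1<k _ S = b-bounds , a-decreasing
  where
  open IsSandwiching S
  open ≤-Reasoning

  b-bounds : ∀ i → i < n → (ms i ≤ b (suc i)) × (b (suc i) < ms (suc i))
  b-bounds i i<n =
    let lower , _ , _ , upper , ms≡ = step i i<n
    in s≤s⁻¹ (monotone-reflects-< (Ack-monoʳ 1<k (a (suc i))) (≤-<-trans lower upper))
     , subst (b (suc i) <_) (sym ms≡) (Ack-inflationary 1<k (a (suc i)) (b (suc i)))

  a-decreasing : ∀ i → 0 < i → i < n → a (suc i) < a i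
  a-decreasing (suc i) _ 1+i<n =
    let i<n = <-trans (n<1+n i) 1+i<n
        lower , _ = step (suc i) 1+i<n
        _ , _ , _ , upper , _ = step i i<n
    in monotone-reflects-< (Ack-monoˡ 1<k (ms (suc i))) (begin-strict
         Ack k (a (suc (suc i))) (ms (suc i)) ≤⟨ lower ⟩
         m                                    <⟨ upper ⟩
         Ack k (a (suc i)) (suc (b (suc i)))  ≤⟨ Ack-monoʳ 1<k (a (suc i)) (proj₂ (b-bounds i i<n)) ⟩
         Ack k (a (suc i)) (ms (suc i))       ∎)
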